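{- Every precedence proper 2-thin graph is perfectly orderable. Moreover, if $V(G)$ is partitioned into two sets $V^1,V^2$ and $<$ is an ordering of $V(G)$ strongly consistent with this partition such that every vertex of $V^1$ is smaller than every vertex of $V^2$, then the ordering $\prec$ consisting of the vertices of $V^1$ in the reverse of $<$, followed by the vertices of $V^2$ in the order $<$, is a perfect order of $G$.
   Context: An ordering $<$ of $V(G)$ is consistent with a partition $\mathcal{V}$ if for every $p<q<r$ with $p,q$ in the same class and $pr\in E(G)$, also $qr\in E(G)$; strongly consistent if both $<$ and its reversal are consistent. A graph is precedence proper 2-thin if $V(G)$ admits a partition into at most 2 classes and a strongly consistent ordering in which each class is consecutive. A vertex ordering $\prec$ of $G$ is perfect if $G$ contains no induced path $abcd$ (edges $ab,bc,cd$) with $a\prec b$ and $d\prec c$; a graph is perfectly orderable if it admits a perfect order. -}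

module Defs where

open import Data.Nat using (ℕ)
open import Data.Fin using (Fin)
open import Data.Bool using (Bool; true; false)
open import Data.Product using (Σ; _×_; ∃-syntax)
open import Data.Sum using (_⊎_)
open import Relation.Nullary using (¬_)
open import Data.Empty using (⊥)
open import Data.Unit using (⊤)
open import Relation.Binary.PropositionalEquality using (_≡_)
open import Relation.Binary.Structures using (IsStrictTotalOrder)

record Graph (n : ℕ) : Set₁ where
  field
    E       : Fin n → Fin n → Set
    E-sym   : ∀ {u v} → E u v → E v u
    E-irrefl : ∀ {u} → ¬ E u u

open Graph public

Ordering : ℕ → Set₁
Ordering n = Fin n → Fin n → Set

IsOrdering : ∀ {n} → Ordering n → Set
IsOrdering _<_ = IsStrictTotalOrder _≡_ _<_

-- A partition into at most two classes, given by a class-label function.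
-- (Classes may be empty, which covers "at most 2".)
Partition2 : ℕ → Set
Partition2 n = Fin n → Bool

rev : ∀ {n} → Ordering n → Ordering n
rev _<_ x y = y < x

Consistent : ∀ {n} → Graph n → Partition2 n → Ordering n → Set
Consistent G cls _<_ =
  ∀ p q r → p < q → q < r → cls p ≡ cls q → E G p r → E G q r

StronglyConsistent : ∀ {n} → Graph n → Partition2 n → Ordering n → Set
StronglyConsistent G cls _<_ = Consistent G cls _<_ × Consistent G cls (rev _<_)

ClassesConsecutive : ∀ {n} → Partition2 n → Ordering n → Set
ClassesConsecutive cls _<_ = ∀ p q r → p < q → q < r → cls p ≡ cls r → cls q ≡ cls p

PrecedenceProper2Thin : ∀ {n} → Graph n → Set₁
PrecedenceProper2Thin {n} G =
  Σ (Partition2 n) λ cls → Σ (Ordering n) λ _<_ →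
    IsOrdering _<_ × StronglyConsistent G cls _<_ × ClassesConsecutive cls _<_

InducedP4 : ∀ {n} → Graph n → Fin n → Fin n → Fin n → Fin n → Set
InducedP4 G a b c d =
  E G a b × E G b c × E G c d × ¬ E G a c × ¬ E G b d × ¬ E G a d

IsPerfectOrder : ∀ {n} → Graph n → Ordering n → Set
IsPerfectOrder G _≺_ =
  IsOrdering _≺_ × (∀ a b c d → InducedP4 G a b c d → a ≺ b → d ≺ c → ⊥)

PerfectlyOrderable : ∀ {n} → Graph n → Set₁
PerfectlyOrderable {n} G = Σ (Ordering n) λ _≺_ → IsPerfectOrder G _≺_

-- V¹ = vertices with label true, V² = vertices with label false.
-- The order ≺: V¹ in reverse of <, followed by V² in the order <.
combined : ∀ {n} → Partition2 n → Ordering n → Ordering n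
combined cls _<_ u v with cls u | cls v
... | true  | true  = v < u
... | true  | false = ⊤
... | false | true  = ⊥
... | false | false = u < v

{-# OPTIONS --safe #-}
module Submission where

-- Strong consistency says: if p and q lie in the same class, pr ∈ E and qr ∉ E,
-- then q is not strictly between p and r in <.  Inside one class, ≺ is < or
-- its reversal, both strongly consistent, and a short comparison argument finds
-- such a forbidden triple in every induced P4 abcd with a ≺ b and d ≺ c.  When
-- the path meets both classes, the fact that all of V¹ precedes all of V² in <
-- supplies the missing comparisons.  For the first claim, two consecutive
-- classes are separated, one entirely before the other; reversing < if needed
-- puts V¹ first.

open import Defs
open import Data.Nat using (ℕ)
open import Data.Fin using (Fin)
open import Data.Fin.Properties using (any?)
open import Data.Bool using (true; false)
open import Data.Bool.Properties using (_≟_)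
open import Data.Product using (_×_; _,_; proj₁; proj₂; swap)
open import Data.Sum using (_⊎_; inj₁; inj₂; [_,_]′)
open import Data.Empty using (⊥; ⊥-elim)
open import Data.Unit using (tt)
open import Relation.Nullary using (¬_; yes; no)
open import Relation.Nullary.Decidable using (_×-dec_)
open import Relation.Binary.PropositionalEquality
  using (_≡_; _≢_; refl; sym; trans; cong; isEquivalence)
open import Relation.Binary.Definitions using (Tri; tri<; tri≈; tri>)
open import Relation.Binary.Structures using (IsStrictTotalOrder)
import Relation.Binary.Construct.Flip.EqAndOrd as Flip

module _ {n : ℕ} {_<_ : Ordering n} (O : IsOrdering _<_) where
  open IsStrictTotalOrder O

  compare-≢ : ∀ {x y} → x ≢ y → x < y ⊎ y < x
  compare-≢ {x} {y} x≢y with compare x y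
  ... | tri< x<y _ _ = inj₁ x<y
  ... | tri≈ _ x≡y _ = ⊥-elim (x≢y x≡y)
  ... | tri> _ _ y<x = inj₂ y<x

rev-isOrdering : ∀ {n} {_<_ : Ordering n} → IsOrdering _<_ → IsOrdering (rev _<_)
rev-isOrdering = Flip.isStrictTotalOrder

rev-stronglyConsistent : ∀ {n} (G : Graph n) (cls : Partition2 n) {_<_ : Ordering n} →
                         StronglyConsistent G cls _<_ → StronglyConsistent G cls (rev _<_)
rev-stronglyConsistent G cls = swap

module _ {n : ℕ} (cls : Partition2 n) where

  classes-≢ : ∀ {x y} → cls x ≡ true → cls y ≡ false → cls x ≢ cls y
  classes-≢ x∈V¹ y∈V² x∼y with trans (sym x∈V¹) (trans x∼y y∈V²)
  ... | ()

  vertices-≢ : ∀ {x y} → cls x ≡ true → cls y ≡ false → x ≢ y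
  vertices-≢ x∈V¹ y∈V² x≡y = classes-≢ x∈V¹ y∈V² (cong cls x≡y)

module _ {n : ℕ} (G : Graph n) where

  E⇒≢ : ∀ {x y} → E G x y → x ≢ y
  E⇒≢ xy refl = E-irrefl G xy

  ¬E-sym : ∀ {x y} → ¬ E G x y → ¬ E G y x
  ¬E-sym ¬xy yx = ¬xy (E-sym G yx)

  module _ {a b c d : Fin n} where

    InducedP4-reverse : InducedP4 G a b c d → InducedP4 G d c b a
    InducedP4-reverse (ab , bc , cd , ¬ac , ¬bd , ¬ad) =
      E-sym G cd , E-sym G bc , E-sym G ab ,
      ¬E-sym ¬bd , ¬E-sym ¬ac , ¬E-sym ¬ad

    InducedP4⇒a≢c : InducedP4 G a b c d → a ≢ c
    InducedP4⇒a≢c (_ , _ , cd , _ , _ , ¬ad) refl = ¬ad cd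

    InducedP4⇒b≢d : InducedP4 G a b c d → b ≢ d
    InducedP4⇒b≢d (ab , _ , _ , _ , _ , ¬ad) refl = ¬ad ab

    InducedP4⇒a≢d : InducedP4 G a b c d → a ≢ d
    InducedP4⇒a≢d (ab , _ , _ , _ , ¬bd , _) refl = ¬bd (E-sym G ab)

Between : ∀ {n} → Ordering n → Fin n → Fin n → Fin n → Set
Between _<_ p q r = (p < q × q < r) ⊎ (r < q × q < p)

module Betweenness {n : ℕ} (G : Graph n) (cls : Partition2 n) {_<_ : Ordering n}
                   (sc : StronglyConsistent G cls _<_) where

  ¬Between : ∀ {k p q r} → cls p ≡ k → cls q ≡ k →
                                E G p r → ¬ E G q r → ¬ Between _<_ p q r
  ¬Between {p = p} {q} {r} p∈k q∈k pr ¬qr (inj₁ (p<q , q<r)) =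
    ¬qr (proj₁ sc p q r p<q q<r (trans p∈k (sym q∈k)) pr)
  ¬Between {p = p} {q} {r} p∈k q∈k pr ¬qr (inj₂ (r<q , q<p)) =
    ¬qr (proj₂ sc p q r q<p r<q (trans p∈k (sym q∈k)) pr)

module _ {n : ℕ} (G : Graph n) (cls : Partition2 n) {_<_ : Ordering n}
         (O : IsOrdering _<_) (sc : StronglyConsistent G cls _<_) where
  open Betweenness G cls sc using (¬Between)

  ¬InducedP4-one-class : ∀ {k a b c d} → InducedP4 G a b c d →
                         cls a ≡ k → cls b ≡ k → cls c ≡ k → cls d ≡ k →
                         a < b → d < c → ⊥
  ¬InducedP4-one-class P@(ab , bc , cd , ¬ac , ¬bd , ¬ad) a∈k b∈k c∈k d∈k a<b d<c
    with compare-≢ O (InducedP4⇒b≢d G P)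
  ... | inj₁ b<d = ¬Between c∈k d∈k (E-sym G bc) (¬E-sym G ¬bd) (inj₂ (b<d , d<c))
  ... | inj₂ d<b with compare-≢ O (E⇒≢ G bc)
  ...   | inj₁ b<c = ¬Between c∈k b∈k cd ¬bd (inj₂ (d<b , b<c))
  ...   | inj₂ c<b with compare-≢ O (InducedP4⇒a≢c G P)
  ...     | inj₂ c<a = ¬Between b∈k a∈k bc ¬ac (inj₂ (c<a , a<b))
  ...     | inj₁ a<c with compare-≢ O (InducedP4⇒a≢d G P)
  ...       | inj₁ a<d = ¬Between a∈k d∈k ab (¬E-sym G ¬bd) (inj₁ (a<d , d<b))
  ...       | inj₂ d<a = ¬Between d∈k a∈k (E-sym G cd) ¬ac (inj₁ (d<a , a<c))

module _ {n : ℕ} (cls : Partition2 n) {_<_ : Ordering n} (O : IsOrdering _<_) where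
  private
    module O = IsStrictTotalOrder O
    _≺_ = combined cls _<_

  combined-irrefl : ∀ {x y} → x ≡ y → ¬ x ≺ y
  combined-irrefl {x} refl with cls x
  ... | true  = O.irrefl refl
  ... | false = O.irrefl refl

  combined-trans : ∀ {x y z} → x ≺ y → y ≺ z → x ≺ z
  combined-trans {x} {y} {z} x≺y y≺z with cls x | cls y | cls z
  ... | true  | true  | true  = O.trans y≺z x≺y
  ... | true  | true  | false = tt
  ... | true  | false | true  = ⊥-elim y≺z
  ... | true  | false | false = tt
  ... | false | true  | _     = ⊥-elim x≺y
  ... | false | false | true  = ⊥-elim y≺z
  ... | false | false | false = O.trans x≺y y≺z

  combined-compare : ∀ x y → Tri (x ≺ y) (x ≡ y) (y ≺ x)
  combined-compare x y with cls x in x∈ | cls y in y∈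
  ... | true | true with O.compare y x
  ...   | tri< y<x y≢x x≮y = tri< y<x (λ x≡y → y≢x (sym x≡y)) x≮y
  ...   | tri≈ y≮x y≡x x≮y = tri≈ y≮x (sym y≡x) x≮y
  ...   | tri> y≮x y≢x x<y = tri> y≮x (λ x≡y → y≢x (sym x≡y)) x<y
  combined-compare x y | true  | false = tri< tt (vertices-≢ cls x∈ y∈) (λ ())
  combined-compare x y | false | true  =
    tri> (λ ()) (λ x≡y → vertices-≢ cls y∈ x∈ (sym x≡y)) tt
  combined-compare x y | false | false = O.compare x y

  combined-isOrdering : IsOrdering _≺_
  combined-isOrdering = record
    { isStrictPartialOrder = record
      { isEquivalence = isEquivalence
      ; irrefl        = combined-irrefl
      ; trans         = λ {x} {y} {z} → combined-trans {x} {y} {z}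
      ; <-resp-≈      = (λ { refl x≺y → x≺y }) , (λ { refl y≺x → y≺x })
      }
    ; compare = combined-compare
    }

data CombinedView {n : ℕ} (cls : Partition2 n) (_<_ : Ordering n) (x y : Fin n) : Set where
  inside¹ : cls x ≡ true  → cls y ≡ true  → y < x → CombinedView cls _<_ x y
  inside² : cls x ≡ false → cls y ≡ false → x < y → CombinedView cls _<_ x y
  across  : cls x ≡ true  → cls y ≡ false →         CombinedView cls _<_ x y

combined⇒view : ∀ {n} {cls : Partition2 n} {_<_ : Ordering n} {x y} →
                combined cls _<_ x y → CombinedView cls _<_ x y
combined⇒view {cls = cls} {x = x} {y} x≺y with cls x in x∈ | cls y in y∈
... | true  | true  = inside¹ x∈ y∈ x≺y
... | true  | false = across x∈ y∈
... | false | false = inside² x∈ y∈ x≺y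

module _ {n : ℕ} (G : Graph n) (cls : Partition2 n) {_<_ : Ordering n}
         (O : IsOrdering _<_) (sc : StronglyConsistent G cls _<_)
         (V¹<V² : ∀ u v → cls u ≡ true → cls v ≡ false → u < v) where
  open Betweenness G cls sc using (¬Between)

  ¬InducedP4-ab∈V¹-c∈V² : ∀ {a b c d} → InducedP4 G a b c d →
                          cls a ≡ true → cls b ≡ true → cls c ≡ false → b < a → ⊥
  ¬InducedP4-ab∈V¹-c∈V² {a} {c = c} (_ , bc , _ , ¬ac , _ , _) a∈ b∈ c∈ b<a =
    ¬Between b∈ a∈ bc ¬ac (inj₁ (b<a , V¹<V² a c a∈ c∈))

  ¬InducedP4-ad∈V¹-bc∈V² : ∀ {a b c d} → InducedP4 G a b c d →
                           cls a ≡ true → cls b ≡ false → cls c ≡ false → cls d ≡ true →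
                           ⊥
  ¬InducedP4-ad∈V¹-bc∈V² {a} {b} {c} {d} P@(ab , _ , cd , ¬ac , ¬bd , _) a∈ b∈ c∈ d∈
    with compare-≢ O (InducedP4⇒a≢d G P)
  ... | inj₁ a<d = ¬Between a∈ d∈ ab (¬E-sym G ¬bd) (inj₁ (a<d , V¹<V² d b d∈ b∈))
  ... | inj₂ d<a = ¬Between d∈ a∈ (E-sym G cd) ¬ac (inj₁ (d<a , V¹<V² a c a∈ c∈))

  ¬InducedP4-abc∈V²-d∈V¹ : ∀ {a b c d} → InducedP4 G a b c d →
                           cls a ≡ false → cls b ≡ false → cls c ≡ false → cls d ≡ true →
                           a < b → ⊥
  ¬InducedP4-abc∈V²-d∈V¹ {a} {d = d} P@(_ , bc , cd , ¬ac , _ , ¬ad) a∈ b∈ c∈ d∈ a<b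
    with compare-≢ O (InducedP4⇒a≢c G P)
  ... | inj₁ a<c = ¬Between c∈ a∈ cd ¬ad (inj₂ (V¹<V² d a d∈ a∈ , a<c))
  ... | inj₂ c<a = ¬Between b∈ a∈ bc ¬ac (inj₂ (c<a , a<b))

  ¬InducedP4-view : ∀ {a b c d} → InducedP4 G a b c d →
                    CombinedView cls _<_ a b → CombinedView cls _<_ d c → ⊥
  ¬InducedP4-view P (inside¹ a∈ b∈ b<a) (inside¹ d∈ c∈ c<d) =
    ¬InducedP4-one-class G cls (rev-isOrdering O) (rev-stronglyConsistent G cls sc)
                         P a∈ b∈ c∈ d∈ b<a c<d
  ¬InducedP4-view P (inside² a∈ b∈ a<b) (inside² d∈ c∈ d<c) =
    ¬InducedP4-one-class G cls O sc P a∈ b∈ c∈ d∈ a<b d<c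
  ¬InducedP4-view P (across a∈ b∈) (across d∈ c∈) =
    ¬InducedP4-ad∈V¹-bc∈V² P a∈ b∈ c∈ d∈
  ¬InducedP4-view P (inside¹ a∈ b∈ b<a) (inside² _ c∈ _) =
    ¬InducedP4-ab∈V¹-c∈V² P a∈ b∈ c∈ b<a
  ¬InducedP4-view P (inside¹ a∈ b∈ b<a) (across _ c∈) =
    ¬InducedP4-ab∈V¹-c∈V² P a∈ b∈ c∈ b<a
  ¬InducedP4-view P (inside² _ b∈ _) (inside¹ d∈ c∈ c<d) =
    ¬InducedP4-ab∈V¹-c∈V² (InducedP4-reverse G P) d∈ c∈ b∈ c<d
  ¬InducedP4-view P (across _ b∈) (inside¹ d∈ c∈ c<d) =
    ¬InducedP4-ab∈V¹-c∈V² (InducedP4-reverse G P) d∈ c∈ b∈ c<d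
  ¬InducedP4-view P (inside² a∈ b∈ a<b) (across d∈ c∈) =
    ¬InducedP4-abc∈V²-d∈V¹ P a∈ b∈ c∈ d∈ a<b
  ¬InducedP4-view P (across a∈ b∈) (inside² d∈ c∈ d<c) =
    ¬InducedP4-abc∈V²-d∈V¹ (InducedP4-reverse G P) d∈ c∈ b∈ a∈ d<c

  combined-isPerfectOrder : IsPerfectOrder G (combined cls _<_)
  combined-isPerfectOrder =
    combined-isOrdering cls O ,
    λ a b c d P a≺b d≺c → ¬InducedP4-view P (combined⇒view a≺b) (combined⇒view d≺c)

module _ {n : ℕ} {cls : Partition2 n} {_<_ : Ordering n}
         (O : IsOrdering _<_) (consecutive : ClassesConsecutive cls _<_) where
  open IsStrictTotalOrder O using (_<?_)

  consecutive⇒¬interleaved : ∀ {u v x y} → cls u ≡ false → cls v ≡ true → u < v →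
                             cls x ≡ true → cls y ≡ false → ¬ x < y
  consecutive⇒¬interleaved {u} {v} {x} {y} u∈V² v∈V¹ u<v x∈V¹ y∈V² x<y
    with compare-≢ O (vertices-≢ cls x∈V¹ u∈V²)
  ... | inj₁ x<u = classes-≢ cls x∈V¹ u∈V²
                     (sym (consecutive x u v x<u u<v (trans x∈V¹ (sym v∈V¹))))
  ... | inj₂ u<x = classes-≢ cls x∈V¹ u∈V²
                     (consecutive u x y u<x x<y (trans u∈V² (sym y∈V²)))

  consecutive⇒separated : (∀ u v → cls u ≡ true → cls v ≡ false → u < v)
                        ⊎ (∀ u v → cls u ≡ true → cls v ≡ false → v < u)
  consecutive⇒separated
    with any? (λ u → any? (λ v → (cls u ≟ false) ×-dec ((cls v ≟ true) ×-dec (u <? v))))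
  ... | yes (u , v , u∈V² , v∈V¹ , u<v) = inj₂ λ x y x∈V¹ y∈V² →
    [ (λ x<y → ⊥-elim (consecutive⇒¬interleaved u∈V² v∈V¹ u<v x∈V¹ y∈V² x<y)) ,
      (λ y<x → y<x)
    ]′ (compare-≢ O (vertices-≢ cls x∈V¹ y∈V²))
  ... | no ¬V²<V¹ = inj₁ λ x y x∈V¹ y∈V² →
    [ (λ x<y → x<y) ,
      (λ y<x → ⊥-elim (¬V²<V¹ (y , x , y∈V² , x∈V¹ , y<x)))
    ]′ (compare-≢ O (vertices-≢ cls x∈V¹ y∈V²))

theorem35 : ((n : ℕ) (G : Graph n) → PrecedenceProper2Thin G → PerfectlyOrderable G)
    × ((n : ℕ) (G : Graph n) (cls : Partition2 n) (_<_ : Ordering n)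
       → IsOrdering _<_
       → StronglyConsistent G cls _<_
       → (∀ u v → cls u ≡ true → cls v ≡ false → u < v)
       → IsPerfectOrder G (combined cls _<_))
theorem35 = precedenceProper2Thin⇒perfectlyOrderable ,
            λ n G cls _<_ → combined-isPerfectOrder G cls
  where
  precedenceProper2Thin⇒perfectlyOrderable : (n : ℕ) (G : Graph n) →
                                             PrecedenceProper2Thin G → PerfectlyOrderable G
  precedenceProper2Thin⇒perfectlyOrderable n G (cls , _<_ , O , sc , consecutive)
    with consecutive⇒separated O consecutive
  ... | inj₁ V¹<V² = combined cls _<_ , combined-isPerfectOrder G cls O sc V¹<V²
  ... | inj₂ V²<V¹ =
    combined cls (rev _<_) ,
    combined-isPerfectOrder G cls (rev-isOrdering O) (rev-stronglyConsistent G cls sc) V²<V¹
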